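{- Let $M$ be a matroid, let $F$ be a base of $M^{\mathrm{fin}}$, and let $B_1,B_2$ be bases of $M$ with $B_1\subseteq F$ and $B_2\subseteq F$. Then either $F\setminus B_1$ and $F\setminus B_2$ are both infinite, or both are finite and $|F\setminus B_1|=|F\setminus B_2|$.
   Context: A matroid is a pair $M=(E,\mathcal L)$, where $E$ is a possibly infinite set and $\mathcal L\subseteq 2^E$ satisfies: (I1) $\emptyset\in\mathcal L$; (I2) if $B\in\mathcal L$ and $A\subseteq B$ then $A\in\mathcal L$; (I3) if $B$ is a maximal element of $\mathcal L$ and $A\in\mathcal L$ is not maximal, then there is $b\in B\setminus A$ with $A\cup\{b\}\in\mathcal L$; (I4) if $A\in\mathcal L$ and $A\subseteq X\subseteq E$, then $\{S\in\mathcal L: A\subseteq S\subseteq X\}$ has a maximal element. Maximal independent sets are bases. The finitarization is $M^{\mathrm{fin}}=(E,\mathcal L^{\mathrm{fin}})$, where $S\in\mathcal L^{\mathrm{fin}}$ iff every finite subset of $S$ is in $\mathcal L$; this is a matroid. -}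

module Defs where

import Level
open import Level using (0ℓ) renaming (suc to lsuc)
open import Data.Nat using (ℕ)
open import Data.Empty using (⊥)
open import Data.List using (List; length)
open import Data.List.Membership.Propositional using (_∈_)
open import Data.List.Relation.Unary.Unique.Propositional using (Unique)
open import Data.Product using (Σ; _×_; ∃; ∃-syntax; _,_)
open import Data.Sum using (_⊎_)
open import Relation.Nullary using (¬_)
open import Relation.Binary.PropositionalEquality using (_≡_)

Subset : Set → Set₁
Subset E = E → Set

module _ {E : Set} where

  _⊆_ : Subset E → Subset E → Set
  A ⊆ B = ∀ x → A x → B x

  _∖_ : Subset E → Subset E → Subset E
  (A ∖ B) x = A x × ¬ B x

  _∪｛_｝ : Subset E → E → Subset E
  (A ∪｛ b ｝) x = A x ⊎ x ≡ b

  Finite : Subset E → Set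
  Finite A = ∃[ xs ] (∀ x → A x → x ∈ xs)

  HasSize : Subset E → ℕ → Set
  HasSize A n = ∃[ xs ] (Unique xs × length xs ≡ n × (∀ x → (A x → x ∈ xs) × (x ∈ xs → A x)))

  Maximal : ∀ {ℓ} → (Subset E → Set ℓ) → Subset E → Set (ℓ Level.⊔ lsuc 0ℓ)
  Maximal 𝓛 S = 𝓛 S × (∀ T → 𝓛 T → S ⊆ T → T ⊆ S)

record Matroid (E : Set) : Set₁ where
  field
    Ind : Subset E → Set
    I1 : Ind (λ _ → ⊥)
    I2 : ∀ A B → Ind B → A ⊆ B → Ind A
    I3 : ∀ A B → Maximal Ind B → Ind A → ¬ Maximal Ind A →
         ∃[ b ] (B b × ¬ A b × Ind (A ∪｛ b ｝))
    I4 : ∀ A X → Ind A → A ⊆ X →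
         Σ (Subset E) λ S → Maximal (λ T → Ind T × A ⊆ T × T ⊆ X) S

module _ {E : Set} (M : Matroid E) where
  open Matroid M

  IsBase : Subset E → Set₁
  IsBase = Maximal Ind

  -- Independent sets of the finitarization: every finite subset is independent.
  IndFin : Subset E → Set₁
  IndFin S = ∀ (A : Subset E) → A ⊆ S → Finite A → Ind A

  IsBaseFin : Subset E → Set₁
  IsBaseFin = Maximal IndFin

module Submission where

-- If F ∖ B is finite with n elements and
-- B' is another base inside F, then B' ∖ B ⊆ F ∖ B is finite, and we induct
-- on its size k.  For k = 0 we get B' ⊆ B, hence B = B' by maximality.
-- Otherwise pick e ∈ B' ∖ B; the exchange property yields b ∈ B ∖ B' such
-- that B'' = (B' - e) + b is again a base.  Now B'' ∖ B has k - 1 elements,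
-- so by induction F ∖ B'' has n elements, and F ∖ B' = (F ∖ B'' - e) + b has
-- n elements as well.  The infinite case follows by symmetry.
--
-- Excluded middle is used to decide membership in arbitrary subsets.

open import Defs
open import Level using (0ℓ) renaming (suc to lsuc)
open import Axiom.ExcludedMiddle using (ExcludedMiddle)
open import Data.Nat using (zero; suc)
open import Data.Product using (_×_; ∃-syntax; _,_; proj₁; proj₂)
open import Data.Sum using (_⊎_; inj₁; inj₂)
open import Data.Empty using (⊥-elim)
open import Relation.Nullary using (¬_; Dec; yes; no)
open import Data.List using (List; []; _∷_; length; filter; deduplicate)
open import Data.List.Membership.Propositional using (_∈_)
open import Data.List.Membership.Propositional.Properties using (∈-filter⁺; ∈-filter⁻; ∈-deduplicate⁺)
open import Data.List.Relation.Unary.Any using (here; there)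
import Data.List.Relation.Unary.All as All
open import Data.List.Relation.Unary.AllPairs using (_∷_)
open import Data.List.Relation.Unary.Unique.Propositional using (Unique)
open import Data.List.Relation.Unary.Unique.Propositional.Properties using (filter⁺)
import Data.List.Relation.Unary.Unique.DecPropositional.Properties as UniqueDec
open import Relation.Binary.PropositionalEquality using (_≡_; refl; sym; subst; cong)

｛_｝ : {E : Set} → E → Subset E
｛ e ｝ x = x ≡ e

module _ {E : Set} where

  infix 4 _≐_
  _≐_ : Subset E → Subset E → Set
  A ≐ B = A ⊆ B × B ⊆ A

  delete : ∀ {xs : List E} {e} → Unique xs → e ∈ xs →
    ∃[ ys ] (Unique ys × suc (length ys) ≡ length xs ×
             (∀ x → (x ∈ xs → ¬ x ≡ e → x ∈ ys) × (x ∈ ys → x ∈ xs × ¬ x ≡ e)))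
  delete {_ ∷ ys} (e∉ys ∷ u) (here refl) = ys , u , refl , λ x →
    (λ { (here x≡e) x≢e → ⊥-elim (x≢e x≡e) ; (there x∈) _ → x∈ })
    , λ x∈ → there x∈ , λ x≡e → All.lookup e∉ys x∈ (sym x≡e)
  delete {y ∷ _} (y∉ ∷ u) (there e∈) with delete u e∈
  ... | ys , u' , len , spec = y ∷ ys , y∉ys ∷ u' , cong suc len , λ x →
    (λ { (here refl) _ → here refl ; (there x∈) x≢e → there (proj₁ (spec x) x∈ x≢e) })
    , λ { (here refl) → here refl , All.lookup y∉ e∈
        ; (there x∈) → there (proj₁ (proj₂ (spec x) x∈)) , proj₂ (proj₂ (spec x) x∈) }
    where
    y∉ys : All.All (λ z → ¬ y ≡ z) ys
    y∉ys = All.tabulate λ z∈ → All.lookup y∉ (proj₁ (proj₂ (spec _) z∈))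

  HasSize-cong : ∀ {A B : Subset E} {n} → A ≐ B → HasSize A n → HasSize B n
  HasSize-cong (A⊆B , B⊆A) (xs , u , len , enum) = xs , u , len , λ x →
    (λ bx → proj₁ (enum x) (B⊆A x bx)) , (λ x∈ → A⊆B x (proj₂ (enum x) x∈))

  HasSize⇒Finite : ∀ {A : Subset E} {n} → HasSize A n → Finite A
  HasSize⇒Finite (xs , _ , _ , enum) = xs , λ x ax → proj₁ (enum x) ax

  Finite-⊆ : ∀ {A B : Subset E} → A ⊆ B → Finite B → Finite A
  Finite-⊆ A⊆B (xs , cover) = xs , λ x ax → cover x (A⊆B x ax)

  Finite⇒HasSize : ExcludedMiddle 0ℓ → ∀ {A : Subset E} → Finite A → ∃[ n ] HasSize A n
  Finite⇒HasSize em {A} (xs , cover) = length ys , ys , unique , refl , λ x →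
    (λ ax → ∈-filter⁺ A? (∈-deduplicate⁺ _≟_ (cover x ax)) ax) , (λ x∈ → proj₂ (∈-filter⁻ A? {xs = deduplicate _≟_ xs} x∈))
    where
    _≟_ : (x y : E) → Dec (x ≡ y)
    _≟_ x y = em {x ≡ y}
    A? : (x : E) → Dec (A x)
    A? x = em {A x}
    ys : List E
    ys = filter A? (deduplicate _≟_ xs)
    unique : Unique ys
    unique = filter⁺ A? (UniqueDec.deduplicate-! _≟_ xs)

  HasSize-zero : ∀ {A : Subset E} {x} → HasSize A zero → ¬ A x
  HasSize-zero ([] , _ , _ , enum) ax with proj₁ (enum _) ax
  ... | ()

  HasSize-suc-inhabited : ∀ {A : Subset E} {k} → HasSize A (suc k) → ∃[ x ] A x
  HasSize-suc-inhabited (x ∷ _ , _ , _ , enum) = x , proj₂ (enum x) (here refl)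

  HasSize-remove : ∀ {A : Subset E} {n e} → HasSize A n → A e →
    ∃[ k ] (n ≡ suc k × HasSize (A ∖ ｛ e ｝) k)
  HasSize-remove (xs , u , refl , enum) ae with delete u (proj₁ (enum _) ae)
  ... | ys , u' , len , spec = length ys , sym len , ys , u' , refl , λ x →
    (λ { (ax , x≢e) → proj₁ (spec x) (proj₁ (enum x) ax) x≢e })
    , λ x∈ → proj₂ (enum x) (proj₁ (proj₂ (spec x) x∈)) , proj₂ (proj₂ (spec x) x∈)

  HasSize-insert : ∀ {A : Subset E} {n b} → HasSize A n → ¬ A b → HasSize (A ∪｛ b ｝) (suc n)
  HasSize-insert {A} {b = b} (xs , u , len , enum) ¬ab =
    b ∷ xs , All.tabulate b∉ ∷ u , cong suc len , λ x → to x , from x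
    where
    b∉ : ∀ {x} → x ∈ xs → ¬ b ≡ x
    b∉ {x} x∈ refl = ¬ab (proj₂ (enum x) x∈)
    to : ∀ x → (A ∪｛ b ｝) x → x ∈ b ∷ xs
    to x (inj₁ ax) = there (proj₁ (enum x) ax)
    to x (inj₂ refl) = here refl
    from : ∀ x → x ∈ b ∷ xs → (A ∪｛ b ｝) x
    from x (here refl) = inj₂ refl
    from x (there x∈) = inj₁ (proj₂ (enum x) x∈)

  HasSize-exchange : ∀ {A : Subset E} {n e b} → HasSize A n → A e → ¬ A b →
    HasSize ((A ∖ ｛ e ｝) ∪｛ b ｝) n
  HasSize-exchange hA ae ¬ab with HasSize-remove hA ae
  ... | k , refl , hA-e = HasSize-insert hA-e (λ { (ab , _) → ¬ab ab })

module _ {E : Set} (M : Matroid E) where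
  open Matroid M

  proper-extension-not-maximal : ∀ {S T : Subset E} {x} → Ind T → S ⊆ T → T x → ¬ S x →
    ¬ Maximal Ind S
  proper-extension-not-maximal indT S⊆T tx ¬sx (_ , maxS) = ¬sx (maxS _ indT S⊆T _ tx)

  base-extension-dependent : ∀ {B : Subset E} {b} → IsBase M B → ¬ B b → ¬ Ind (B ∪｛ b ｝)
  base-extension-dependent baseB ¬bb ind =
    proper-extension-not-maximal ind (λ x bx → inj₁ bx) (inj₂ refl) ¬bb baseB

  base-exchange : ExcludedMiddle 0ℓ → ∀ {B B' : Subset E} {e} → IsBase M B → IsBase M B' →
    B' e → ¬ B e → ∃[ b ] (B b × ¬ B' b × IsBase M ((B' ∖ ｛ e ｝) ∪｛ b ｝))
  base-exchange em {B} {B'} {e} baseB baseB' b'e ¬be with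
    I3 (B' ∖ ｛ e ｝) B baseB (I2 _ B' (proj₁ baseB') (λ x → proj₁))
       (proper-extension-not-maximal (proj₁ baseB') (λ x → proj₁) b'e (λ { (_ , e≢e) → e≢e refl }))
  ... | b , bb , ¬b∈B'-e , indB'' = b , bb , ¬b'b , indB'' , maximal
    where
    ¬b'b : ¬ B' b
    ¬b'b b'b = ¬b∈B'-e (b'b , λ { refl → ¬be bb })
    B'' : Subset E
    B'' = (B' ∖ ｛ e ｝) ∪｛ b ｝
    -- Were B'' not a base, it could only be extended from B' by e,
    -- but B'' + e contains B' + b, which is dependent.
    maximal : ∀ T → Ind T → B'' ⊆ T → T ⊆ B''
    maximal T indT B''⊆T x tx with em {B'' x}
    ... | yes b''x = b''x
    ... | no ¬b''x with I3 B'' B' baseB' indB'' (proper-extension-not-maximal indT B''⊆T tx ¬b''x)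
    ... | y , b'y , ¬b''y , indB''+y with em {y ≡ e}
    ... | no y≢e = ⊥-elim (¬b''y (inj₁ (b'y , y≢e)))
    ... | yes refl = ⊥-elim (base-extension-dependent baseB' ¬b'b (I2 _ _ indB''+y B'+b⊆B''+e))
      where
      B'+b⊆B''+e : (B' ∪｛ b ｝) ⊆ (B'' ∪｛ e ｝)
      B'+b⊆B''+e z (inj₂ refl) = inj₁ (inj₂ refl)
      B'+b⊆B''+e z (inj₁ b'z) with em {z ≡ e}
      ... | yes z≡e = inj₂ z≡e
      ... | no z≢e = inj₁ (inj₁ (b'z , z≢e))

module _ {E : Set} where

  exchange-outside : ∀ {B B' : Subset E} {e b} → B b →
    (B' ∖ B) ∖ ｛ e ｝ ≐ ((B' ∖ ｛ e ｝) ∪｛ b ｝) ∖ B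
  exchange-outside bb =
    (λ { x ((b'x , ¬bx) , x≢e) → inj₁ (b'x , x≢e) , ¬bx })
    , λ { x (inj₁ (b'x , x≢e) , ¬bx) → (b'x , ¬bx) , x≢e ; x (inj₂ refl , ¬bx) → ⊥-elim (¬bx bb) }

  exchange-complement : ExcludedMiddle 0ℓ → ∀ {F B' : Subset E} {e b} → F b → ¬ B' b → B' e →
    ((F ∖ ((B' ∖ ｛ e ｝) ∪｛ b ｝)) ∖ ｛ e ｝) ∪｛ b ｝ ≐ F ∖ B'
  exchange-complement em {F} {B'} {e} {b} fb ¬b'b b'e = to , from
    where
    to : (((F ∖ ((B' ∖ ｛ e ｝) ∪｛ b ｝)) ∖ ｛ e ｝) ∪｛ b ｝) ⊆ (F ∖ B')
    to x (inj₁ ((fx , ¬b''x) , x≢e)) = fx , λ b'x → ¬b''x (inj₁ (b'x , x≢e))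
    to x (inj₂ refl) = fb , ¬b'b
    from : (F ∖ B') ⊆ (((F ∖ ((B' ∖ ｛ e ｝) ∪｛ b ｝)) ∖ ｛ e ｝) ∪｛ b ｝)
    from x (fx , ¬b'x) with em {x ≡ b}
    ... | yes x≡b = inj₂ x≡b
    ... | no x≢b = inj₁ ((fx , λ { (inj₁ (b'x , _)) → ¬b'x b'x ; (inj₂ x≡b) → x≢b x≡b })
                        , λ { refl → ¬b'x b'e })

module _ (em : ExcludedMiddle 0ℓ) {E : Set} (M : Matroid E) {F : Subset E} where

  complement-size-transfer : ∀ {B B' : Subset E} {m} k → IsBase M B → IsBase M B' →
    B ⊆ F → B' ⊆ F → HasSize (B' ∖ B) k → HasSize (F ∖ B) m → HasSize (F ∖ B') m
  complement-size-transfer {B} {B'} zero baseB baseB' _ _ h₀ hF∖B =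
    HasSize-cong (complement-⊆ B'⊆B , complement-⊆ B⊆B') hF∖B
    where
    B'⊆B : B' ⊆ B
    B'⊆B x b'x with em {B x}
    ... | yes bx = bx
    ... | no ¬bx = ⊥-elim (HasSize-zero h₀ (b'x , ¬bx))
    B⊆B' : B ⊆ B'
    B⊆B' = proj₂ baseB' B (proj₁ baseB) B'⊆B
    complement-⊆ : ∀ {C D : Subset E} → D ⊆ C → (F ∖ C) ⊆ (F ∖ D)
    complement-⊆ D⊆C x (fx , ¬cx) = fx , λ dx → ¬cx (D⊆C x dx)
  complement-size-transfer {B} {B'} (suc k) baseB baseB' B⊆F B'⊆F hB'∖B hF∖B
    with HasSize-suc-inhabited hB'∖B
  ... | e , b'e , ¬be with base-exchange M em baseB baseB' b'e ¬be | HasSize-remove hB'∖B (b'e , ¬be)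
  ... | b , bb , ¬b'b , baseB'' | .k , refl , hB'∖B-e =
    HasSize-cong (exchange-complement em (B⊆F b bb) ¬b'b b'e)
      (HasSize-exchange hF∖B'' (B'⊆F e b'e , e∉B'') (λ { (_ , ¬b''b) → ¬b''b (inj₂ refl) }))
    where
    B''⊆F : ((B' ∖ ｛ e ｝) ∪｛ b ｝) ⊆ F
    B''⊆F x (inj₁ (b'x , _)) = B'⊆F x b'x
    B''⊆F x (inj₂ refl) = B⊆F b bb
    e∉B'' : ¬ ((B' ∖ ｛ e ｝) ∪｛ b ｝) e
    e∉B'' (inj₁ (_ , e≢e)) = e≢e refl
    e∉B'' (inj₂ refl) = ¬b'b b'e
    hF∖B'' : HasSize (F ∖ ((B' ∖ ｛ e ｝) ∪｛ b ｝)) _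
    hF∖B'' = complement-size-transfer k baseB baseB'' B⊆F B''⊆F
               (HasSize-cong (exchange-outside bb) hB'∖B-e) hF∖B

  finite-complements-equal : ∀ {B B' : Subset E} → IsBase M B → IsBase M B' → B ⊆ F → B' ⊆ F →
    Finite (F ∖ B) → ∃[ n ] (HasSize (F ∖ B) n × HasSize (F ∖ B') n)
  finite-complements-equal baseB baseB' B⊆F B'⊆F fin
    with Finite⇒HasSize em fin
       | Finite⇒HasSize em (Finite-⊆ (λ x (b'x , ¬bx) → B'⊆F x b'x , ¬bx) fin)
  ... | n , hF∖B | k , hB'∖B = n , hF∖B , complement-size-transfer k baseB baseB' B⊆F B'⊆F hB'∖B hF∖B

theorem3p1p2 : ExcludedMiddle 0ℓ → ExcludedMiddle (lsuc 0ℓ) →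
    {E : Set} (M : Matroid E) (F B₁ B₂ : Subset E) →
    IsBaseFin M F → IsBase M B₁ → IsBase M B₂ → B₁ ⊆ F → B₂ ⊆ F →
    (¬ Finite (F ∖ B₁) × ¬ Finite (F ∖ B₂))
    ⊎ (∃[ n ] (HasSize (F ∖ B₁) n × HasSize (F ∖ B₂) n))
theorem3p1p2 em _ M F B₁ B₂ _ base₁ base₂ B₁⊆F B₂⊆F with em {Finite (F ∖ B₁)}
... | yes fin₁ = inj₂ (finite-complements-equal em M base₁ base₂ B₁⊆F B₂⊆F fin₁)
... | no ¬fin₁ = inj₁ (¬fin₁ , λ fin₂ → ¬fin₁ (HasSize⇒Finite (proj₂ (proj₂
        (finite-complements-equal em M base₂ base₁ B₂⊆F B₁⊆F fin₂)))))
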